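{- Let $n\geq 2$ and $k_1,\dots,k_n\geq 3$ be integers such that the torus $T_{k_1,\ldots,k_n}$ is bipartite. Then $fmp(T_{k_1,\ldots ,k_n})=2n$ and $fsmp(T_{k_1,\ldots ,k_n})=1$.
   Context: The $n$-dimensional torus $T_{k_1,\ldots,k_n}$ (with $k_i\geq 3$) has vertex set $\{(x_1,\dots,x_n):0\leq x_i\leq k_i-1\}$, two vertices being adjacent iff they differ in exactly one coordinate $i$ and there $a_i-b_i\equiv\pm1\pmod{k_i}$. A fractional perfect matching of $G$ is $g:E(G)\to[0,1]$ with $\sum_{e\ni v}g(e)=1$ for all $v$. $fmp(G)$ (resp. $fsmp(G)$) is the minimum size of a set $F\subseteq E(G)$ (resp. $F\subseteq V(G)\cup E(G)$) whose deletion (vertices with incident edges, and edges) leaves a graph with no fractional perfect matching.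
   Formalization: The fractional perfect matchings take rational values in $[0,1]$ in place of real ones. -}

module Defs where

open import Data.Nat using (ℕ; zero; suc; _+_; _<_)
open import Data.Nat.DivMod using (_mod_)
open import Data.Fin using (Fin; toℕ; _≟_)
open import Data.Bool using (Bool)
open import Data.Product using (Σ; _×_; _,_)
open import Data.Sum using (_⊎_; inj₁; inj₂)
open import Data.Empty using (⊥)
open import Data.List using (List; length; map)
open import Data.List.Relation.Unary.Any using (Any)
open import Data.Rational using (ℚ; 0ℚ; 1ℚ; _≤_) renaming (_+_ to _+ℚ_)
open import Relation.Binary.PropositionalEquality using (_≡_; _≢_; refl)
open import Relation.Nullary using (¬_; yes; no)

sucMod : ∀ {m} → Fin m → Fin m
sucMod {suc m} a = suc (toℕ a) mod suc m

predMod : ∀ {m} → Fin m → Fin m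
predMod {suc m} a = (toℕ a + m) mod suc m

Vertex : (n : ℕ) (k : Fin n → ℕ) → Set
Vertex n k = (i : Fin n) → Fin (k i)

_≈V_ : ∀ {n k} → Vertex n k → Vertex n k → Set
x ≈V y = ∀ i → x i ≡ y i

shift : ∀ {n k} → Vertex n k → Fin n → Vertex n k
shift x i j with j ≟ i
... | yes refl = sucMod (x i)
... | no _ = x j

unshift : ∀ {n k} → Vertex n k → Fin n → Vertex n k
unshift x i j with j ≟ i
... | yes refl = predMod (x i)
... | no _ = x j

-- Edges: the edge (x , i) is {x , x + e_i}.  Two vertices of the torus
-- are adjacent iff they differ in exactly one coordinate i, by ±1 mod k_i,
-- i.e. iff they are {x , x + e_i} for some x, i; since k_i ≥ 3 every edge
-- has exactly one such representation (up to ≈V).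
Edge : (n : ℕ) (k : Fin n → ℕ) → Set
Edge n k = Vertex n k × Fin n

_≈E_ : ∀ {n k} → Edge n k → Edge n k → Set
(x , i) ≈E (y , j) = x ≈V y × i ≡ j

Bipartite : (n : ℕ) (k : Fin n → ℕ) → Set
Bipartite n k =
  Σ (Vertex n k → Bool) λ c →
    (∀ x y → x ≈V y → c x ≡ c y) × (∀ x i → c x ≢ c (shift x i))

Elem : (n : ℕ) (k : Fin n → ℕ) → Set
Elem n k = Vertex n k ⊎ Edge n k

VHit : ∀ {n k} → Vertex n k → Elem n k → Set
VHit v (inj₁ w) = w ≈V v
VHit v (inj₂ _) = ⊥

EHit : ∀ {n k} → Edge n k → Elem n k → Set
EHit e (inj₁ _) = ⊥
EHit e (inj₂ f) = f ≈E e

VDel : ∀ {n k} → List (Elem n k) → Vertex n k → Set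
VDel F v = Any (VHit v) F

EDel : ∀ {n k} → List (Elem n k) → Edge n k → Set
EDel F (x , i) = Any (EHit (x , i)) F ⊎ VDel F x ⊎ VDel F (shift x i)

sumFin : ∀ n → (Fin n → ℚ) → ℚ
sumFin zero f = 0ℚ
sumFin (suc n) f = f Fin.zero +ℚ sumFin n (λ i → f (Fin.suc i))

-- Fractional perfect matching of T - F.  g is a weighting of the edges of
-- T - F; it is represented as a function on all edges of T which is 0 on
-- the absent edges (and respects edge equality).  The edges of T incident
-- with v are (v , i) and (v - e_i , i) for i : Fin n.
HasFPM : (n : ℕ) (k : Fin n → ℕ) → List (Elem n k) → Set
HasFPM n k F =
  Σ (Edge n k → ℚ) λ g →
    (∀ e f → e ≈E f → g e ≡ g f) ×
    (∀ e → ¬ EDel F e → (0ℚ ≤ g e) × (g e ≤ 1ℚ)) ×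
    (∀ e → EDel F e → g e ≡ 0ℚ) ×
    (∀ v → ¬ VDel F v →
       sumFin n (λ i → g (v , i) +ℚ g (unshift v i , i)) ≡ 1ℚ)

IsFmp : (n : ℕ) (k : Fin n → ℕ) → ℕ → Set
IsFmp n k m =
  (Σ (List (Edge n k)) λ F → length F ≡ m × ¬ HasFPM n k (map inj₂ F)) ×
  (∀ (F : List (Edge n k)) → length F < m → HasFPM n k (map inj₂ F))

IsFsmp : (n : ℕ) (k : Fin n → ℕ) → ℕ → Set
IsFsmp n k m =
  (Σ (List (Elem n k)) λ F → length F ≡ m × ¬ HasFPM n k F) ×
  (∀ (F : List (Elem n k)) → length F < m → HasFPM n k F)

module Submission where

-- Fix a proper 2-colouring c of the torus.  For a direction i and a colour b, the
-- edges (x , i) with c x ≡ b form a perfect matching; these 2n matchings are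
-- pairwise disjoint, so fewer than 2n deleted edges miss one of them, whereas
-- deleting the 2n edges at a vertex isolates it.
-- For any edge weighting every edge gives its weight to one vertex of each colour,
-- so the sum of the degrees, signed by colour, vanishes.  Doing this for a perfect
-- matching of the torus and for a fractional perfect matching of the torus minus v₀
-- yields a function supported on v₀ whose sum is 0 but whose value at v₀ is ±1.

open import Defs
open import Data.Nat using (ℕ; _≤_; _*_)
open import Data.Fin using (Fin)
open import Data.Product using (_×_)

open import Data.Bool using (Bool; true; false; not; if_then_else_)
import Data.Bool as Bool
import Data.Bool.Properties as Boolₚ
open import Data.Fin using (zero; suc; toℕ; fromℕ<; _≟_; combine; remQuot; punchIn)
open import Data.Fin.Permutation using (Permutation; permutation)
import Data.Fin.Properties as Finₚ
open import Data.List using (List; []; _∷_; length; map; tabulate; _++_; lookup)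
open import Data.List.Membership.Propositional using (_∈_; _∉_)
open import Data.List.Membership.Propositional.Properties using (∈-++⁺ˡ; ∈-++⁺ʳ; ∈-tabulate⁺)
import Data.List.Properties as Listₚ
open import Data.List.Relation.Unary.Any as Any using (Any; here; there)
import Data.List.Relation.Unary.Any.Properties as Anyₚ
open import Data.Nat using (zero; suc; _<_; z≤n; s≤s; NonZero)
import Data.Nat as ℕ
open import Data.Nat.DivMod using (_%_; %-distribˡ-+; m%n%n≡m%n; [m+n]%n≡m%n; m<n⇒m%n≡m)
import Data.Nat.Properties as ℕₚ
open import Data.Product using (_,_; proj₁; proj₂; ∃)
open import Data.Rational using (ℚ; 0ℚ; 1ℚ; _+_; -_)
import Data.Rational as ℚ
import Data.Rational.Properties as ℚₚ
open import Algebra.Properties.CommutativeMonoid.Sum ℚₚ.+-0-commutativeMonoid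
  using (sum; sum-syntax; sum-cong-≗; sum-replicate-zero; sum-remove; ∑-distrib-+; ∑-comm; ∑-permute)
open import Data.Sum using (inj₁; inj₂)
open import Function using (_∘_; Inverse)
open import Function.Definitions using (Congruent; Injective)
open import Relation.Binary.PropositionalEquality
open import Relation.Nullary using (¬_; Dec; does; yes; no; contradiction)
open import Relation.Nullary.Decidable using (dec-true; dec-false; _×-dec_)

%-absorbʳ : ∀ m n d .{{_ : NonZero d}} → (m ℕ.+ n % d) % d ≡ (m ℕ.+ n) % d
%-absorbʳ m n d = begin
  (m ℕ.+ n % d) % d             ≡⟨ %-distribˡ-+ m (n % d) d ⟩
  (m % d ℕ.+ n % d % d) % d     ≡⟨ cong (λ t → (m % d ℕ.+ t) % d) (m%n%n≡m%n n d) ⟩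
  (m % d ℕ.+ n % d) % d         ≡⟨ %-distribˡ-+ m n d ⟨
  (m ℕ.+ n) % d                 ∎
  where open ≡-Reasoning

toℕ-sucMod : ∀ {m} (a : Fin (suc m)) → toℕ (sucMod a) ≡ suc (toℕ a) % suc m
toℕ-sucMod a = Finₚ.toℕ-fromℕ< _

toℕ-predMod : ∀ {m} (a : Fin (suc m)) → toℕ (predMod a) ≡ (toℕ a ℕ.+ m) % suc m
toℕ-predMod a = Finₚ.toℕ-fromℕ< _

sucMod-predMod : ∀ {m} (a : Fin m) → sucMod (predMod a) ≡ a
sucMod-predMod {suc m} a = Finₚ.toℕ-injective (begin
  toℕ (sucMod (predMod a))              ≡⟨ toℕ-sucMod (predMod a) ⟩
  (1 ℕ.+ toℕ (predMod a)) % suc m       ≡⟨ cong (λ t → (1 ℕ.+ t) % suc m) (toℕ-predMod a) ⟩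
  (1 ℕ.+ (toℕ a ℕ.+ m) % suc m) % suc m ≡⟨ %-absorbʳ 1 (toℕ a ℕ.+ m) (suc m) ⟩
  suc (toℕ a ℕ.+ m) % suc m             ≡⟨ cong (_% suc m) (ℕₚ.+-suc (toℕ a) m) ⟨
  (toℕ a ℕ.+ suc m) % suc m             ≡⟨ [m+n]%n≡m%n (toℕ a) (suc m) ⟩
  toℕ a % suc m                         ≡⟨ m<n⇒m%n≡m (Finₚ.toℕ<n a) ⟩
  toℕ a                                 ∎)
  where open ≡-Reasoning

predMod-sucMod : ∀ {m} (a : Fin m) → predMod (sucMod a) ≡ a
predMod-sucMod {suc m} a = Finₚ.toℕ-injective (begin
  toℕ (predMod (sucMod a))              ≡⟨ toℕ-predMod (sucMod a) ⟩
  (toℕ (sucMod a) ℕ.+ m) % suc m        ≡⟨ cong (λ t → (t ℕ.+ m) % suc m) (toℕ-sucMod a) ⟩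
  (suc (toℕ a) % suc m ℕ.+ m) % suc m   ≡⟨ cong (_% suc m) (ℕₚ.+-comm (suc (toℕ a) % suc m) m) ⟩
  (m ℕ.+ suc (toℕ a) % suc m) % suc m   ≡⟨ %-absorbʳ m (suc (toℕ a)) (suc m) ⟩
  (m ℕ.+ suc (toℕ a)) % suc m           ≡⟨ cong (_% suc m) (ℕₚ.+-comm m (suc (toℕ a))) ⟩
  suc (toℕ a ℕ.+ m) % suc m             ≡⟨ cong (_% suc m) (ℕₚ.+-suc (toℕ a) m) ⟨
  (toℕ a ℕ.+ suc m) % suc m             ≡⟨ [m+n]%n≡m%n (toℕ a) (suc m) ⟩
  toℕ a % suc m                         ≡⟨ m<n⇒m%n≡m (Finₚ.toℕ<n a) ⟩
  toℕ a                                 ∎)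
  where open ≡-Reasoning

module _ {n : ℕ} {k : Fin n → ℕ} where

  ≈V-trans : {x y z : Vertex n k} → x ≈V y → y ≈V z → x ≈V z
  ≈V-trans x≈y y≈z i = trans (x≈y i) (y≈z i)

  shift-self : (x : Vertex n k) (i : Fin n) → shift x i i ≡ sucMod (x i)
  shift-self x i with i ≟ i
  ... | yes refl = refl
  ... | no i≢i   = contradiction refl i≢i

  shift-other : (x : Vertex n k) {i j : Fin n} → j ≢ i → shift x i j ≡ x j
  shift-other x {i} {j} j≢i with j ≟ i
  ... | yes j≡i = contradiction j≡i j≢i
  ... | no _    = refl

  unshift-self : (x : Vertex n k) (i : Fin n) → unshift x i i ≡ predMod (x i)
  unshift-self x i with i ≟ i
  ... | yes refl = refl
  ... | no i≢i   = contradiction refl i≢i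

  unshift-other : (x : Vertex n k) {i j : Fin n} → j ≢ i → unshift x i j ≡ x j
  unshift-other x {i} {j} j≢i with j ≟ i
  ... | yes j≡i = contradiction j≡i j≢i
  ... | no _    = refl

  shift-unshift : (x : Vertex n k) (i : Fin n) → shift (unshift x i) i ≈V x
  shift-unshift x i j with j ≟ i
  ... | yes refl = trans (cong sucMod (unshift-self x j)) (sucMod-predMod (x j))
  ... | no j≢i   = unshift-other x j≢i

  unshift-shift : (x : Vertex n k) (i : Fin n) → unshift (shift x i) i ≈V x
  unshift-shift x i j with j ≟ i
  ... | yes refl = trans (cong predMod (shift-self x j)) (predMod-sucMod (x j))
  ... | no j≢i   = shift-other x j≢i

  shift-cong : {x y : Vertex n k} (i : Fin n) → x ≈V y → shift x i ≈V shift y i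
  shift-cong i x≈y j with j ≟ i
  ... | yes refl = cong sucMod (x≈y j)
  ... | no _     = x≈y j

  unshift-cong : {x y : Vertex n k} (i : Fin n) → x ≈V y → unshift x i ≈V unshift y i
  unshift-cong i x≈y j with j ≟ i
  ... | yes refl = cong predMod (x≈y j)
  ... | no _     = x≈y j

-- Vertices are enumerated in mixed radix, so that sums over vertices are sums over
-- Fin and their invariance under a shift is an instance of ∑-permute.
vertexCount : (n : ℕ) → (Fin n → ℕ) → ℕ
vertexCount zero    k = 1
vertexCount (suc n) k = k zero * vertexCount n (k ∘ suc)

cons : ∀ {n} {k : Fin (suc n) → ℕ} → Fin (k zero) → Vertex n (k ∘ suc) → Vertex (suc n) k
cons a w zero    = a
cons a w (suc i) = w i

encode : ∀ {n} {k : Fin n → ℕ} → Vertex n k → Fin (vertexCount n k)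
encode {zero}  v = zero
encode {suc n} v = combine (v zero) (encode (v ∘ suc))

decode : ∀ {n} (k : Fin n → ℕ) → Fin (vertexCount n k) → Vertex n k
decode {suc n} k j = cons (proj₁ q) (decode (k ∘ suc) (proj₂ q))
  where q = remQuot {k zero} (vertexCount n (k ∘ suc)) j

encode-decode : ∀ {n} (k : Fin n → ℕ) (j : Fin (vertexCount n k)) → encode (decode k j) ≡ j
encode-decode {zero}  k zero = refl
encode-decode {suc n} k j    =
  trans (cong (combine (proj₁ q)) (encode-decode (k ∘ suc) (proj₂ q)))
        (Finₚ.combine-remQuot {k zero} (vertexCount n (k ∘ suc)) j)
  where q = remQuot {k zero} (vertexCount n (k ∘ suc)) j

decode-encode : ∀ {n} {k : Fin n → ℕ} (v : Vertex n k) → decode k (encode v) ≈V v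
decode-encode {suc n} v zero    = cong proj₁ (Finₚ.remQuot-combine (v zero) (encode (v ∘ suc)))
decode-encode {suc n} v (suc i) = trans
  (cong (λ q → decode _ (proj₂ q) i) (Finₚ.remQuot-combine (v zero) (encode (v ∘ suc))))
  (decode-encode (v ∘ suc) i)

encode-cong : ∀ {n} {k : Fin n → ℕ} → Congruent _≈V_ _≡_ (encode {n} {k})
encode-cong {zero}  x≈y = refl
encode-cong {suc n} x≈y = cong₂ combine (x≈y zero) (encode-cong (x≈y ∘ suc))

sumFin≡sum : ∀ n (f : Fin n → ℚ) → sumFin n f ≡ sum f
sumFin≡sum zero    f = refl
sumFin≡sum (suc n) f = cong (f zero +_) (sumFin≡sum n (f ∘ suc))

sum-zeros : ∀ {m} {f : Fin m → ℚ} → (∀ i → f i ≡ 0ℚ) → sum f ≡ 0ℚ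
sum-zeros {m} f≗0 = trans (sum-cong-≗ f≗0) (sum-replicate-zero m)

sum-single : ∀ {m} (f : Fin m → ℚ) (i₀ : Fin m) → (∀ i → i ≢ i₀ → f i ≡ 0ℚ) → sum f ≡ f i₀
sum-single {suc m} f i₀ vanishes = begin
  sum f                     ≡⟨ sum-remove {i = i₀} f ⟩
  f i₀ + sum (f ∘ punchIn i₀) ≡⟨ cong (f i₀ +_) (sum-zeros (λ j → vanishes _ (Finₚ.punchInᵢ≢i i₀ j))) ⟩
  f i₀ + 0ℚ                 ≡⟨ ℚₚ.+-identityʳ (f i₀) ⟩
  f i₀                      ∎
  where open ≡-Reasoning

sum-additive : (h : ℚ → ℚ) → h 0ℚ ≡ 0ℚ → (∀ x y → h (x + y) ≡ h x + h y) →
               ∀ {m} (f : Fin m → ℚ) → h (sum f) ≡ sum (h ∘ f)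
sum-additive h h-0 h-+ {zero}  f = h-0
sum-additive h h-0 h-+ {suc m} f =
  trans (h-+ (f zero) (sum (f ∘ suc))) (cong (h (f zero) +_) (sum-additive h h-0 h-+ (f ∘ suc)))

module _ {n : ℕ} {k : Fin n → ℕ} where

  sumV : (Vertex n k → ℚ) → ℚ
  sumV φ = sum (φ ∘ decode k)

  sumV-+ : (φ ψ : Vertex n k → ℚ) → sumV (λ v → φ v + ψ v) ≡ sumV φ + sumV ψ
  sumV-+ φ ψ = ∑-distrib-+ (φ ∘ decode k) (ψ ∘ decode k)

  sumV-zeros : {φ : Vertex n k → ℚ} → (∀ v → φ v ≡ 0ℚ) → sumV φ ≡ 0ℚ
  sumV-zeros φ≗0 = sum-zeros (φ≗0 ∘ decode k)

  sumV-shift : {φ : Vertex n k → ℚ} → Congruent _≈V_ _≡_ φ → ∀ i →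
               sumV (λ v → φ (shift v i)) ≡ sumV φ
  sumV-shift {φ} φ-cong i = sym (begin
    sum (φ ∘ decode k)                                 ≡⟨ ∑-permute (φ ∘ decode k) π ⟩
    sum (λ j → φ (decode k (encode (shift (decode k j) i))))
      ≡⟨ sum-cong-≗ (λ j → φ-cong (decode-encode (shift (decode k j) i))) ⟩
    sum (λ j → φ (shift (decode k j) i))               ∎)
    where
    open ≡-Reasoning
    π : Permutation (vertexCount n k) (vertexCount n k)
    π = permutation (λ j → encode (shift (decode k j) i)) (λ j → encode (unshift (decode k j) i))
      (λ j → trans (encode-cong (≈V-trans (shift-cong i (decode-encode _)) (shift-unshift _ i)))
                   (encode-decode k j))
      (λ j → trans (encode-cong (≈V-trans (unshift-cong i (decode-encode _)) (unshift-shift _ i)))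
                   (encode-decode k j))

  sumV-single : {φ : Vertex n k → ℚ} → Congruent _≈V_ _≡_ φ → (v₀ : Vertex n k) →
                (∀ v → ¬ v₀ ≈V v → φ v ≡ 0ℚ) → sumV φ ≡ φ v₀
  sumV-single {φ} φ-cong v₀ vanishes =
    trans (sum-single (φ ∘ decode k) (encode v₀) off) (φ-cong (decode-encode v₀))
    where
    off : ∀ j → j ≢ encode v₀ → φ (decode k j) ≡ 0ℚ
    off j j≢v₀ = vanishes (decode k j) λ v₀≈ →
      j≢v₀ (trans (sym (encode-decode k j)) (encode-cong (λ i → sym (v₀≈ i))))

signed : Bool → ℚ → ℚ
signed true  x = x
signed false x = - x

signed-0 : ∀ b → signed b 0ℚ ≡ 0ℚ
signed-0 true  = refl
signed-0 false = refl

signed-+ : ∀ b x y → signed b (x + y) ≡ signed b x + signed b y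
signed-+ true  x y = refl
signed-+ false x y = ℚₚ.neg-distrib-+ x y

signed-cancel : ∀ b x → signed b x + signed (not b) x ≡ 0ℚ
signed-cancel true  x = ℚₚ.+-inverseʳ x
signed-cancel false x = ℚₚ.+-inverseˡ x

signed-1≢0 : ∀ b → signed b 1ℚ ≢ 0ℚ
signed-1≢0 true  ()
signed-1≢0 false ()

module _ {n : ℕ} {k : Fin n → ℕ} where

  record ProperColouring (c : Vertex n k → Bool) : Set where
    field
      colour-cong  : Congruent _≈V_ _≡_ c
      colour-shift : ∀ x i → c (shift x i) ≡ not (c x)

  open ProperColouring

  properColouring-not : {c : Vertex n k → Bool} → ProperColouring c → ProperColouring (not ∘ c)
  properColouring-not proper = record
    { colour-cong  = cong not ∘ colour-cong proper
    ; colour-shift = λ x i → cong not (colour-shift proper x i)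
    }

  degree : (Edge n k → ℚ) → Vertex n k → ℚ
  degree g v = sum (λ i → g (v , i) + g (unshift v i , i))

  degree-cong : {g : Edge n k → ℚ} → Congruent _≈E_ _≡_ g → Congruent _≈V_ _≡_ (degree g)
  degree-cong g-cong {x} {y} x≈y = sum-cong-≗ λ i →
    cong₂ _+_ (g-cong {x , i} {y , i} (x≈y , refl))
              (g-cong {unshift x i , i} {unshift y i , i} (unshift-cong i x≈y , refl))

  sumV-signedDegree : {c : Vertex n k → Bool} → ProperColouring c →
                      {g : Edge n k → ℚ} → Congruent _≈E_ _≡_ g →
                      sumV (λ v → signed (c v) (degree g v)) ≡ 0ℚ
  sumV-signedDegree {c} proper {g} g-cong = begin
    sumV (λ v → signed (c v) (degree g v))         ≡⟨ sum-cong-≗ (signed-degree ∘ decode k) ⟩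
    sum (λ j → ∑[ i < n ] (out i (decode k j) + in′ i (decode k j)))
      ≡⟨ ∑-comm (λ j i → out i (decode k j) + in′ i (decode k j)) ⟩
    ∑[ i < n ] sumV (λ v → out i v + in′ i v)     ≡⟨ sum-zeros balanced ⟩
    0ℚ                                            ∎
    where
    open ≡-Reasoning
    out in′ : Fin n → Vertex n k → ℚ
    out i v = signed (c v) (g (v , i))
    in′ i v = signed (c v) (g (unshift v i , i))

    signed-degree : ∀ v → signed (c v) (degree g v) ≡ ∑[ i < n ] (out i v + in′ i v)
    signed-degree v = trans
      (sum-additive (signed (c v)) (signed-0 (c v)) (signed-+ (c v)) (λ i → g (v , i) + g (unshift v i , i)))
      (sum-cong-≗ λ i → signed-+ (c v) (g (v , i)) (g (unshift v i , i)))

    in′-cong : ∀ i → Congruent _≈V_ _≡_ (in′ i)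
    in′-cong i {x} {y} x≈y = cong₂ signed (colour-cong proper x≈y)
      (g-cong {unshift x i , i} {unshift y i , i} (unshift-cong i x≈y , refl))

    in′-shift : ∀ i v → in′ i (shift v i) ≡ signed (not (c v)) (g (v , i))
    in′-shift i v = cong₂ signed (colour-shift proper v i)
      (g-cong {unshift (shift v i) i , i} {v , i} (unshift-shift v i , refl))

    balanced : ∀ i → sumV (λ v → out i v + in′ i v) ≡ 0ℚ
    balanced i = begin
      sumV (λ v → out i v + in′ i v)                ≡⟨ sumV-+ (out i) (in′ i) ⟩
      sumV (out i) + sumV (in′ i)                   ≡⟨ cong (sumV (out i) +_) (sumV-shift (in′-cong i) i) ⟨
      sumV (out i) + sumV (λ v → in′ i (shift v i)) ≡⟨ sumV-+ (out i) (λ v → in′ i (shift v i)) ⟨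
      sumV (λ v → out i v + in′ i (shift v i))
        ≡⟨ sumV-zeros (λ v → trans (cong (out i v +_) (in′-shift i v)) (signed-cancel (c v) (g (v , i)))) ⟩
      0ℚ                                            ∎

  fpm-degree : ∀ {F} {g : Edge n k → ℚ} →
               (∀ v → ¬ VDel F v → sumFin n (λ i → g (v , i) + g (unshift v i , i)) ≡ 1ℚ) →
               ∀ v → ¬ VDel F v → degree g v ≡ 1ℚ
  fpm-degree {g = g} deg v v∉F =
    trans (sym (sumFin≡sum n (λ i → g (v , i) + g (unshift v i , i)))) (deg v v∉F)

  Isolated : List (Elem n k) → Vertex n k → Set
  Isolated F v = ∀ i → EDel F (v , i) × EDel F (unshift v i , i)

  isolated⇒degree≡0 : ∀ {F} {g : Edge n k → ℚ} → (∀ e → EDel F e → g e ≡ 0ℚ) →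
                      ∀ {v} → Isolated F v → degree g v ≡ 0ℚ
  isolated⇒degree≡0 absent cut = sum-zeros λ i →
    cong₂ _+_ (absent _ (proj₁ (cut i))) (absent _ (proj₂ (cut i)))

  isolated⇒¬HasFPM : ∀ {F v} → ¬ VDel F v → Isolated F v → ¬ HasFPM n k F
  isolated⇒¬HasFPM {v = v} v∉F cut (g , _ , _ , absent , deg) =
    0ℚ≢1ℚ (trans (sym (isolated⇒degree≡0 {g = g} absent cut)) (fpm-degree {g = g} deg v v∉F))
    where
    0ℚ≢1ℚ : 0ℚ ≢ 1ℚ
    0ℚ≢1ℚ ()

  VDel-cong : ∀ {F} {v w : Vertex n k} → v ≈V w → VDel F v → VDel F w
  VDel-cong v≈w = Any.map hit
    where
    hit : ∀ {e} → VHit _ e → VHit _ e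
    hit {inj₁ u} u≈v i = trans (u≈v i) (v≈w i)

  deleted⇒isolated : ∀ {F v} → VDel F v → Isolated F v
  deleted⇒isolated {v = v} v∈F i =
    inj₂ (inj₁ v∈F) , inj₂ (inj₂ (VDel-cong (λ j → sym (shift-unshift v i j)) v∈F))

  edgeDeletion-¬VDel : (F : List (Edge n k)) {v : Vertex n k} → ¬ VDel (map inj₂ F) v
  edgeDeletion-¬VDel (_ ∷ F) (there v∈F) = edgeDeletion-¬VDel F v∈F

  ∈⇒EDel : ∀ {F : List (Edge n k)} {e} → e ∈ F → EDel (map inj₂ F) e
  ∈⇒EDel e∈F = inj₁ (Anyₚ.map⁺ (Any.map (λ { refl → (λ _ → refl) , refl }) e∈F))

  outgoingEdges incomingEdges incidentEdges : Vertex n k → List (Edge n k)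
  outgoingEdges v = tabulate (v ,_)
  incomingEdges v = tabulate (λ i → unshift v i , i)
  incidentEdges v = outgoingEdges v ++ incomingEdges v

  length-incidentEdges : ∀ v → length (incidentEdges v) ≡ 2 * n
  length-incidentEdges v = begin
    length (outgoingEdges v ++ incomingEdges v)           ≡⟨ Listₚ.length-++ (outgoingEdges v) ⟩
    length (outgoingEdges v) ℕ.+ length (incomingEdges v)
      ≡⟨ cong₂ ℕ._+_ (Listₚ.length-tabulate (v ,_)) (Listₚ.length-tabulate (λ i → unshift v i , i)) ⟩
    n ℕ.+ n                                               ≡⟨ cong (n ℕ.+_) (ℕₚ.+-identityʳ n) ⟨
    2 * n                                                 ∎
    where open ≡-Reasoning

  incidentEdges-¬HasFPM : ∀ v → ¬ HasFPM n k (map inj₂ (incidentEdges v))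
  incidentEdges-¬HasFPM v = isolated⇒¬HasFPM (edgeDeletion-¬VDel (incidentEdges v)) λ i →
    ∈⇒EDel (∈-++⁺ˡ (∈-tabulate⁺ i)) , ∈⇒EDel (∈-++⁺ʳ (outgoingEdges v) (∈-tabulate⁺ i))

  vertexDeletion-¬HasFPM : {c : Vertex n k → Bool} → ProperColouring c → HasFPM n k [] →
                           ∀ v₀ → ¬ HasFPM n k (inj₁ v₀ ∷ [])
  vertexDeletion-¬HasFPM {c} proper (m , m-cong , _ , _ , m-deg) v₀ (g , g-cong , _ , absent , g-deg) =
    signed-1≢0 (c v₀) (begin
      signed (c v₀) 1ℚ        ≡⟨ ℚₚ.+-identityʳ _ ⟨
      signed (c v₀) 1ℚ + 0ℚ   ≡⟨ cong₂ (λ x y → signed (c v₀) x + y) (m-degree v₀) g-signedDegree₀ ⟨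
      φ v₀                    ≡⟨ sumV-single φ-cong v₀ φ-vanishes ⟨
      sumV φ                  ≡⟨ sumV-+ (λ v → signed (c v) (degree m v)) (λ v → signed (not (c v)) (degree g v)) ⟩
      sumV (λ v → signed (c v) (degree m v)) + sumV (λ v → signed (not (c v)) (degree g v))
        ≡⟨ cong₂ _+_ (sumV-signedDegree proper m-cong′) (sumV-signedDegree (properColouring-not proper) g-cong′) ⟩
      0ℚ                      ∎)
    where
    open ≡-Reasoning
    m-cong′ : Congruent _≈E_ _≡_ m
    m-cong′ {e} {f} = m-cong e f

    g-cong′ : Congruent _≈E_ _≡_ g
    g-cong′ {e} {f} = g-cong e f

    m-degree : ∀ v → degree m v ≡ 1ℚ
    m-degree v = fpm-degree {g = m} m-deg v λ ()

    g-signedDegree₀ : signed (not (c v₀)) (degree g v₀) ≡ 0ℚ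
    g-signedDegree₀ = trans
      (cong (signed (not (c v₀))) (isolated⇒degree≡0 {g = g} absent (deleted⇒isolated (here (λ _ → refl)))))
      (signed-0 (not (c v₀)))

    φ : Vertex n k → ℚ
    φ v = signed (c v) (degree m v) + signed (not (c v)) (degree g v)

    φ-cong : Congruent _≈V_ _≡_ φ
    φ-cong x≈y = cong₂ _+_ (cong₂ signed (colour-cong proper x≈y) (degree-cong m-cong′ x≈y))
                           (cong₂ signed (cong not (colour-cong proper x≈y)) (degree-cong g-cong′ x≈y))

    φ-vanishes : ∀ v → ¬ v₀ ≈V v → φ v ≡ 0ℚ
    φ-vanishes v v₀≉v = begin
      φ v                                     ≡⟨ cong₂ (λ x y → signed (c v) x + signed (not (c v)) y)
                                                       (m-degree v) (fpm-degree {g = g} g-deg v v∉) ⟩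
      signed (c v) 1ℚ + signed (not (c v)) 1ℚ ≡⟨ signed-cancel (c v) 1ℚ ⟩
      0ℚ                                      ∎
      where
      v∉ : ¬ VDel (inj₁ v₀ ∷ []) v
      v∉ (here v₀≈v) = v₀≉v v₀≈v

length<⇒∃∉ : ∀ {m} (xs : List (Fin m)) → length xs < m → ∃ λ j → j ∉ xs
length<⇒∃∉ {m} xs |xs|<m = Finₚ.¬∀⟶∃¬ m (_∈ xs) (λ j → Any.any? (j ≟_) xs) λ all∈ →
  Finₚ.<⇒notInjective |xs|<m (index-injective all∈)
  where
  index-injective : (all∈ : ∀ j → j ∈ xs) → Injective _≡_ _≡_ (Any.index ∘ all∈)
  index-injective all∈ {i} {j} eq = begin
    i                              ≡⟨ Anyₚ.lookup-index (all∈ i) ⟩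
    lookup xs (Any.index (all∈ i)) ≡⟨ cong (lookup xs) eq ⟩
    lookup xs (Any.index (all∈ j)) ≡⟨ Anyₚ.lookup-index (all∈ j) ⟨
    j                              ∎
    where open ≡-Reasoning

indicator : {P : Set} → Dec P → ℚ
indicator p = if does p then 1ℚ else 0ℚ

indicator-bounds : {P : Set} (p : Dec P) → 0ℚ ℚ.≤ indicator p × indicator p ℚ.≤ 1ℚ
indicator-bounds (yes _) = ℚₚ.nonNegative⁻¹ 1ℚ , ℚₚ.≤-refl
indicator-bounds (no _)  = ℚₚ.≤-refl , ℚₚ.nonNegative⁻¹ 1ℚ

indicator-¬ : {P : Set} (p : Dec P) → ¬ P → indicator p ≡ 0ℚ
indicator-¬ p ¬P rewrite dec-false p ¬P = refl

indicator-not : ∀ b b₀ → indicator (b Bool.≟ b₀) + indicator (not b Bool.≟ b₀) ≡ 1ℚ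
indicator-not false false = refl
indicator-not false true  = refl
indicator-not true  false = refl
indicator-not true  true  = refl

module ClassMatching {n : ℕ} {k : Fin n → ℕ} {c : Vertex n k → Bool} (proper : ProperColouring c) where

  open ProperColouring proper

  colour-unshift : ∀ v i → c (unshift v i) ≡ not (c v)
  colour-unshift v i = trans (sym (Boolₚ.not-involutive _))
    (cong not (trans (sym (colour-shift (unshift v i) i)) (colour-cong (shift-unshift v i))))

  InClass : Fin n → Bool → Edge n k → Set
  InClass i₀ b₀ (x , i) = i ≡ i₀ × c x ≡ b₀

  classMatching : Fin n → Bool → Edge n k → ℚ
  classMatching i₀ b₀ (x , i) = indicator (i ≟ i₀ ×-dec c x Bool.≟ b₀)

  classMatching-cong : ∀ i₀ b₀ → Congruent _≈E_ _≡_ (classMatching i₀ b₀)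
  classMatching-cong i₀ b₀ {x , i} (x≈y , refl) =
    cong (λ b → indicator (i ≟ i₀ ×-dec b Bool.≟ b₀)) (colour-cong x≈y)

  classMatching-degree : ∀ i₀ b₀ v → degree (classMatching i₀ b₀) v ≡ 1ℚ
  classMatching-degree i₀ b₀ v = trans (sum-single _ i₀ other) self
    where
    other : ∀ i → i ≢ i₀ → classMatching i₀ b₀ (v , i) + classMatching i₀ b₀ (unshift v i , i) ≡ 0ℚ
    other i i≢i₀ = cong₂ _+_ (indicator-¬ (i ≟ i₀ ×-dec c v Bool.≟ b₀) (i≢i₀ ∘ proj₁))
                             (indicator-¬ (i ≟ i₀ ×-dec c (unshift v i) Bool.≟ b₀) (i≢i₀ ∘ proj₁))

    self : classMatching i₀ b₀ (v , i₀) + classMatching i₀ b₀ (unshift v i₀ , i₀) ≡ 1ℚ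
    self rewrite dec-true (i₀ ≟ i₀) refl | colour-unshift v i₀ = indicator-not (c v) b₀

  classMatching-HasFPM : ∀ i₀ b₀ F → (∀ e → EDel F e → ¬ InClass i₀ b₀ e) → HasFPM n k F
  classMatching-HasFPM i₀ b₀ F avoids =
      classMatching i₀ b₀
    , (λ _ _ → classMatching-cong i₀ b₀)
    , (λ { (x , i) _ → indicator-bounds (i ≟ i₀ ×-dec c x Bool.≟ b₀) })
    , (λ { (x , i) del → indicator-¬ (i ≟ i₀ ×-dec c x Bool.≟ b₀) (avoids (x , i) del) })
    , (λ v _ → trans (sumFin≡sum n _) (classMatching-degree i₀ b₀ v))

  torus-HasFPM : Fin n → HasFPM n k []
  torus-HasFPM i₀ = classMatching-HasFPM i₀ true [] λ
    { _ (inj₁ ()) ; _ (inj₂ (inj₁ ())) ; _ (inj₂ (inj₂ ())) }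

  classIndex : Bool → Fin n → Fin (2 * n)
  classIndex b i = combine (Inverse.from Finₚ.2↔Bool b) i

  edgeClass : Edge n k → Fin (2 * n)
  edgeClass (x , i) = classIndex (c x) i

  classIndex-surjective : ∀ j → ∃ λ b → ∃ λ i → classIndex b i ≡ j
  classIndex-surjective j with q , i , refl ← Finₚ.combine-surjective {2} {n} j =
    Inverse.to Finₚ.2↔Bool q , i , cong (λ q → combine q i) (Inverse.strictlyInverseʳ Finₚ.2↔Bool q)

  deletedEdge-class∈ : ∀ {F : List (Edge n k)} {e} → Any (EHit e) (map inj₂ F) →
                       edgeClass e ∈ map edgeClass F
  deletedEdge-class∈ {e = x , i} hit = Anyₚ.map⁺ (Any.map
    (λ { {y , .i} (y≈x , refl) → cong (λ b → classIndex b i) (sym (colour-cong y≈x)) })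
    (Anyₚ.map⁻ hit))

  fewEdges-HasFPM : ∀ (F : List (Edge n k)) → length F < 2 * n → HasFPM n k (map inj₂ F)
  fewEdges-HasFPM F |F|<2n
    with j , j∉ ← length<⇒∃∉ (map edgeClass F) (subst (_< 2 * n) (sym (Listₚ.length-map edgeClass F)) |F|<2n)
    with b₀ , i₀ , refl ← classIndex-surjective j =
    classMatching-HasFPM i₀ b₀ (map inj₂ F) avoids
    where
    avoids : ∀ e → EDel (map inj₂ F) e → ¬ InClass i₀ b₀ e
    avoids _ (inj₁ hit)         (refl , refl) = j∉ (deletedEdge-class∈ hit)
    avoids _ (inj₂ (inj₁ x∈F)) _ = edgeDeletion-¬VDel F x∈F
    avoids _ (inj₂ (inj₂ y∈F)) _ = edgeDeletion-¬VDel F y∈F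

theorem4p8 : (n : ℕ) (k : Fin n → ℕ) → 2 ≤ n → (∀ i → 3 ≤ k i) →
    Bipartite n k → IsFmp n k (2 * n) × IsFsmp n k 1
theorem4p8 n k 2≤n 3≤k (c , c-cong , c-proper) =
    ((incidentEdges v₀ , length-incidentEdges v₀ , incidentEdges-¬HasFPM v₀) , fewEdges-HasFPM)
  , ((inj₁ v₀ ∷ [] , refl , vertexDeletion-¬HasFPM proper perfect v₀)
    , λ { [] _ → perfect ; (_ ∷ _) (s≤s ()) })
  where
  proper : ProperColouring c
  proper = record
    { colour-cong  = λ {x} {y} → c-cong x y
    ; colour-shift = λ x i → Boolₚ.¬-not (c-proper x i ∘ sym)
    }

  open ClassMatching proper

  perfect : HasFPM n k []
  perfect = torus-HasFPM (fromℕ< 2≤n)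

  v₀ : Vertex n k
  v₀ i = fromℕ< (ℕₚ.<-≤-trans (s≤s z≤n) (3≤k i))
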